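{- Let $p$ be a formal parameter and let $U=\begin{pmatrix} p & 1\\ 0 & 1\end{pmatrix}$. For every $x\in\mathbf Q^+$, the Taylor expansion at $p=0$ of $[x]_U=\sum_{n=0}^{\infty}a_np^n$ has integral coefficients, i.e. $a_n\in\mathbf Z$ for all $n$.
   Context: For $U=\begin{pmatrix} p & q\\ r & s\end{pmatrix}$, let $f_U:\mathbf Q^+\to\mathbf C$ be the unique solution of the system $f(1+x)=p\,f(x)+q\,f(1/x)$, $f\!\left(\frac{x}{1+x}\right)=r\,f(x)+s\,f(1/x)$ with $f(1)=1$ (existence and uniqueness follow by induction on the sum of the partial quotients of $x$). Define the $U$-deformation of $x\in\mathbf Q^+$ by $[x]_U:=\frac{f_U(x)}{f_U(1/x)}$. In the case $U=\begin{pmatrix} p & 1\\ 0 & 1\end{pmatrix}$ the system reads $f(1+x)=p\,f(x)+f(1/x)$, $f\!\left(\frac{x}{1+x}\right)=f(1/x)$; then $[1+x]_U=p+\frac{1}{[x]_U}$, $[1/x]_U=1/[x]_U$, $[1]_U=1$, so $[x]_U$ is a rational function of $p$ (for integer $n$, $f_U(n)$ is a Fibonacci-type polynomial $F_n(p)$ with $F_{n}=pF_{n-1}+F_{n-2}$, $F_1=1$, $F_2=1+p$). -}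

module Defs where

open import Data.Nat as ℕ using (ℕ; zero; suc; _∸_)
open import Data.Integer as ℤ using (ℤ)
open import Data.Rational as ℚ using (ℚ; Positive; NonZero; 0ℚ; 1ℚ; _+_; _*_; _÷_; 1/_)
open import Data.Rational.Properties using (pos⇒nonZero; pos+pos⇒pos)
open import Data.List using (List; map; upTo)
open import Data.Fin using ()

-- Formal power series in the parameter p with rational coefficients:
-- s n is the coefficient of p^n.
Series : Set
Series = ℕ → ℚ

pTimes : Series → Series
pTimes s zero    = 0ℚ
pTimes s (suc n) = s n

oneS : Series
oneS zero    = 1ℚ
oneS (suc n) = 0ℚ

sumℚ : List ℚ → ℚ
sumℚ = Data.List.foldr _+_ 0ℚ

_·S_ : Series → Series → Series
(s ·S t) n = sumℚ (map (λ k → s k * t (n ∸ k)) (upTo (suc n)))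

fromℤS : (ℕ → ℤ) → Series
fromℤS a n = a n ℚ./ 1

inv : (x : ℚ) → Positive x → ℚ
inv x px = (1/ x) {{pos⇒nonZero x {{px}}}}

onePlus : ℚ → ℚ
onePlus x = 1ℚ + x

over1+ : (x : ℚ) → Positive x → ℚ
over1+ x px = (x ÷ (1ℚ + x)) {{pos⇒nonZero (1ℚ + x) {{pos+pos⇒pos 1ℚ {{_}} x {{px}}}}}}

-- f : ℚ⁺ → ℚ[[p]] solves the system for U = (p 1; 0 1):
--   f(1+x) = p f(x) + f(1/x),  f(x/(1+x)) = f(1/x),  f(1) = 1
IsFU : (ℚ → Series) → Set
IsFU f =
  (∀ x (px : Positive x) n → f (onePlus x) n ≡ pTimes (f x) n + f (inv x px) n) ×
  (∀ x (px : Positive x) n → f (over1+ x px) n ≡ f (inv x px) n) ×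
  (∀ n → f 1ℚ n ≡ oneS n)
  where
  open import Relation.Binary.PropositionalEquality using (_≡_)
  open import Data.Product using (_×_)

-- Call f_U(x) normalised if it has integer coefficients and constant term 1.  Every positive
-- rational is reached from 1 by x ↦ 1 + x and x ↦ x/(1+x) (subtractive Euclid run backwards),
-- and the defining system computes f_U at both children from f_U(x) and f_U(1/x) using only
-- addition and multiplication by p, so f_U(x) and f_U(1/x) are normalised for every x > 0.
-- Long division by a normalised series keeps integer coefficients, hence so does
-- [x]_U = f_U(x) / f_U(1/x).
module Submission where

open import Defs
open import Data.Nat as ℕ using (ℕ; zero; suc; _∸_)
import Data.Nat.Properties as ℕ
open import Data.Nat.Induction using (<-rec)
import Data.Nat.Solver
open import Data.Integer as ℤ using (ℤ; +[1+_])
import Data.Integer.Properties as ℤ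
open import Data.Rational
  using (ℚ; mkℚ; Positive; NonZero; 0ℚ; 1ℚ; _/_; _+_; _*_; -_; _-_; _÷_; 1/_; toℚᵘ)
open import Data.Rational.Properties
  using ( toℚᵘ-injective; toℚᵘ-fromℚᵘ; fromℚᵘ-cong; toℚᵘ-homo-+; toℚᵘ-homo-*; toℚᵘ-homo‿-
        ; /-cong; normalize-pos; pos⇒nonZero; pos+pos⇒pos; ↥p/↧p≡p; 1/pos⇒pos; 1≢0
        ; +-identityˡ; +-identityʳ; +-assoc; *-identityˡ; *-identityʳ; *-assoc; *-inverseʳ)
import Data.Rational.Solver
open import Data.Rational.Unnormalised as ℚᵘ using (mkℚᵘ; *≡*) renaming (_≃_ to _≃ᵘ_)
import Data.Rational.Unnormalised.Properties as ℚᵘ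
open import Data.List using (map; upTo; applyUpTo)
open import Data.List.Properties using (map-applyUpTo; map-cong)
open import Data.Product using (∃; _×_; _,_; proj₁; proj₂; swap; uncurry)
open import Data.Empty using (⊥-elim)
open import Function using (id; _∘_)
open import Relation.Binary.PropositionalEquality
open ≡-Reasoning

shift : Series → Series
shift s n = s (suc n)

·S-zero : ∀ s t → (s ·S t) 0 ≡ s 0 * t 0
·S-zero s t = +-identityʳ (s 0 * t 0)

·S-suc : ∀ s t n → (s ·S t) (suc n) ≡ s 0 * t (suc n) + (shift s ·S t) n
·S-suc s t n = cong (λ xs → s 0 * t (suc n) + sumℚ xs) (begin
  map h (applyUpTo suc (suc n))  ≡⟨ map-applyUpTo suc h (suc n) ⟩
  applyUpTo (h ∘ suc) (suc n)    ≡⟨ map-applyUpTo id (h ∘ suc) (suc n) ⟨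
  map (h ∘ suc) (upTo (suc n))   ∎)
  where
  h : ℕ → ℚ
  h k = s k * t (suc n ∸ k)

·S-sucʳ : ∀ s t n → (s ·S t) (suc n) ≡ (s ·S shift t) n + s (suc n) * t 0
·S-sucʳ s t zero = begin
  (s ·S t) 1                     ≡⟨ ·S-suc s t 0 ⟩
  s 0 * t 1 + (shift s ·S t) 0   ≡⟨ cong (s 0 * t 1 +_) (·S-zero (shift s) t) ⟩
  s 0 * t 1 + s 1 * t 0          ≡⟨ cong (_+ s 1 * t 0) (·S-zero s (shift t)) ⟨
  (s ·S shift t) 0 + s 1 * t 0   ∎
·S-sucʳ s t (suc n) = begin
  (s ·S t) (2 ℕ.+ n)
    ≡⟨ ·S-suc s t (suc n) ⟩
  s 0 * t (2 ℕ.+ n) + (shift s ·S t) (suc n)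
    ≡⟨ cong (s 0 * t (2 ℕ.+ n) +_) (·S-sucʳ (shift s) t n) ⟩
  s 0 * t (2 ℕ.+ n) + ((shift s ·S shift t) n + s (2 ℕ.+ n) * t 0)
    ≡⟨ +-assoc (s 0 * t (2 ℕ.+ n)) _ _ ⟨
  s 0 * t (2 ℕ.+ n) + (shift s ·S shift t) n + s (2 ℕ.+ n) * t 0
    ≡⟨ cong (_+ s (2 ℕ.+ n) * t 0) (·S-suc s (shift t) n) ⟨
  (s ·S shift t) (suc n) + s (2 ℕ.+ n) * t 0
    ∎

·S-congʳ : ∀ s {t u} → (∀ n → t n ≡ u n) → ∀ n → (s ·S t) n ≡ (s ·S u) n
·S-congʳ s t≗u n = cong sumℚ (map-cong (λ k → cong (s k *_) (t≗u (n ∸ k))) (upTo (suc n)))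

-- If t₀ = 1, then q = s ÷S t has q₀ = s₀, and shift q solves t · q′ = shift s − s₀ · shift t.
_÷S_ : Series → Series → Series
(s ÷S t) zero    = s 0
(s ÷S t) (suc n) = ((λ k → s (suc k) - s 0 * t (suc k)) ÷S t) n

·S-÷S : ∀ t → t 0 ≡ 1ℚ → ∀ s n → (t ·S (s ÷S t)) n ≡ s n
·S-÷S t t0≡1 s zero = begin
  (t ·S (s ÷S t)) 0  ≡⟨ ·S-zero t (s ÷S t) ⟩
  t 0 * s 0          ≡⟨ cong (_* s 0) t0≡1 ⟩
  1ℚ * s 0           ≡⟨ *-identityˡ (s 0) ⟩
  s 0                ∎
·S-÷S t t0≡1 s (suc n) = begin
  (t ·S (s ÷S t)) (suc n)                        ≡⟨ ·S-sucʳ t (s ÷S t) n ⟩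
  (t ·S shift (s ÷S t)) n + t (suc n) * s 0      ≡⟨ cong (_+ t (suc n) * s 0) (·S-÷S t t0≡1 _ n) ⟩
  s (suc n) - s 0 * t (suc n) + t (suc n) * s 0  ≡⟨ solve 3 (λ a b c → a :- b :* c :+ c :* b := a)
                                                            refl (s (suc n)) (s 0) (t (suc n)) ⟩
  s (suc n)                                      ∎
  where open Data.Rational.Solver.+-*-Solver

fromℤ : ℤ → ℚ
fromℤ i = i / 1

IsInteger : ℚ → Set
IsInteger q = ∃ λ i → q ≡ fromℤ i

IntegerSeries : Series → Set
IntegerSeries s = ∀ n → IsInteger (s n)

toℚᵘ-/ : ∀ i d → toℚᵘ (i / suc d) ≃ᵘ mkℚᵘ i d
toℚᵘ-/ i d = toℚᵘ-fromℚᵘ (mkℚᵘ i d)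

/-cross : ∀ i c j d .{{_ : ℕ.NonZero c}} .{{_ : ℕ.NonZero d}} →
          i ℤ.* ℤ.+ d ≡ j ℤ.* ℤ.+ c → i / c ≡ j / d
/-cross i (suc c) j (suc d) eq = fromℚᵘ-cong {mkℚᵘ i c} {mkℚᵘ j d} (*≡* eq)

/-+-/ : ∀ i j c d → i / suc c + j / suc d ≡ (i ℤ.* ℤ.+ suc d ℤ.+ j ℤ.* ℤ.+ suc c) / (suc c ℕ.* suc d)
/-+-/ i j c d = toℚᵘ-injective (ℚᵘ.≃-trans (toℚᵘ-homo-+ (i / suc c) (j / suc d))
  (ℚᵘ.≃-trans (ℚᵘ.+-cong (toℚᵘ-/ i c) (toℚᵘ-/ j d)) (ℚᵘ.≃-sym (toℚᵘ-/ _ _))))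

/-*-/ : ∀ i j c d → (i / suc c) * (j / suc d) ≡ (i ℤ.* j) / (suc c ℕ.* suc d)
/-*-/ i j c d = toℚᵘ-injective (ℚᵘ.≃-trans (toℚᵘ-homo-* (i / suc c) (j / suc d))
  (ℚᵘ.≃-trans (ℚᵘ.*-cong (toℚᵘ-/ i c) (toℚᵘ-/ j d)) (ℚᵘ.≃-sym (toℚᵘ-/ _ _))))

fromℤ-+ : ∀ i j → fromℤ i + fromℤ j ≡ fromℤ (i ℤ.+ j)
fromℤ-+ i j = trans (/-+-/ i j 0 0) (/-cong (cong₂ ℤ._+_ (ℤ.*-identityʳ i) (ℤ.*-identityʳ j)) refl)

fromℤ-* : ∀ i j → fromℤ i * fromℤ j ≡ fromℤ (i ℤ.* j)
fromℤ-* i j = /-*-/ i j 0 0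

fromℤ-neg : ∀ i → - fromℤ i ≡ fromℤ (ℤ.- i)
fromℤ-neg i = toℚᵘ-injective
  (ℚᵘ.≃-trans (toℚᵘ-homo‿- (fromℤ i)) (ℚᵘ.≃-trans (ℚᵘ.-‿cong (toℚᵘ-/ i 0)) (ℚᵘ.≃-sym (toℚᵘ-/ (ℤ.- i) 0))))

isInteger-0 : IsInteger 0ℚ
isInteger-0 = ℤ.+ 0 , refl

isInteger-1 : IsInteger 1ℚ
isInteger-1 = ℤ.+ 1 , refl

isInteger-+ : ∀ {p q} → IsInteger p → IsInteger q → IsInteger (p + q)
isInteger-+ (i , refl) (j , refl) = i ℤ.+ j , fromℤ-+ i j

isInteger-* : ∀ {p q} → IsInteger p → IsInteger q → IsInteger (p * q)
isInteger-* (i , refl) (j , refl) = i ℤ.* j , fromℤ-* i j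

isInteger-neg : ∀ {p} → IsInteger p → IsInteger (- p)
isInteger-neg (i , refl) = ℤ.- i , fromℤ-neg i

÷S-integer : ∀ {s t} → IntegerSeries s → IntegerSeries t → IntegerSeries (s ÷S t)
÷S-integer sℤ tℤ zero    = sℤ 0
÷S-integer sℤ tℤ (suc n) =
  ÷S-integer (λ k → isInteger-+ (sℤ (suc k)) (isInteger-neg (isInteger-* (sℤ 0) (tℤ (suc k))))) tℤ n

÷-unique : ∀ p q .{{_ : NonZero q}} r → r * q ≡ p → p ÷ q ≡ r
÷-unique p q r r*q≡p = begin
  p * 1/ q          ≡⟨ cong (_* 1/ q) r*q≡p ⟨
  r * q * 1/ q      ≡⟨ *-assoc r q (1/ q) ⟩
  r * (q * 1/ q)    ≡⟨ cong (r *_) (*-inverseʳ q) ⟩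
  r * 1ℚ            ≡⟨ *-identityʳ r ⟩
  r                 ∎

1/-unique : ∀ q .{{_ : NonZero q}} r → r * q ≡ 1ℚ → 1/ q ≡ r
1/-unique q r r*q≡1 = trans (sym (*-identityˡ (1/ q))) (÷-unique 1ℚ q r r*q≡1)

frac : ℕ → ℕ → ℚ
frac m n = +[1+ m ] / suc n

frac-positive : ∀ m n → Positive (frac m n)
frac-positive m n = normalize-pos (suc m) (suc n)

frac-diag : ∀ m → frac m m ≡ 1ℚ
frac-diag m = /-cross +[1+ m ] (suc m) (ℤ.+ 1) 1 (ℤ.*-comm +[1+ m ] (ℤ.+ 1))

frac-*-swap : ∀ m n → frac m n * frac n m ≡ 1ℚ
frac-*-swap m n = begin
  frac m n * frac n m                          ≡⟨ /-*-/ +[1+ m ] +[1+ n ] n m ⟩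
  (+[1+ m ] ℤ.* +[1+ n ]) / (suc n ℕ.* suc m)  ≡⟨ /-cross (+[1+ m ] ℤ.* +[1+ n ]) (suc n ℕ.* suc m)
                                                          (ℤ.+ 1) 1 (cong ℤ.+_ cross) ⟩
  1ℚ                                           ∎
  where
  open Data.Nat.Solver.+-*-Solver
  cross : suc m ℕ.* suc n ℕ.* 1 ≡ 1 ℕ.* (suc n ℕ.* suc m)
  cross = solve 2 (λ m n → (con 1 :+ m) :* (con 1 :+ n) :* con 1
                         := con 1 :* ((con 1 :+ n) :* (con 1 :+ m))) refl m n

inv-frac : ∀ m n p → inv (frac m n) p ≡ frac n m
inv-frac m n p = 1/-unique (frac m n) {{pos⇒nonZero (frac m n) {{p}}}} (frac n m) (frac-*-swap n m)

onePlus-frac : ∀ m n → onePlus (frac m n) ≡ frac (suc (n ℕ.+ m)) n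
onePlus-frac m n = begin
  1ℚ + frac m n                                   ≡⟨ /-+-/ (ℤ.+ 1) +[1+ m ] 0 n ⟩
  (ℤ.+ 1 ℤ.* ℤ.+ suc n ℤ.+ +[1+ m ] ℤ.* ℤ.+ 1) / (1 ℕ.* suc n)
    ≡⟨ /-cross (ℤ.+ 1 ℤ.* ℤ.+ suc n ℤ.+ +[1+ m ] ℤ.* ℤ.+ 1) (1 ℕ.* suc n)
               +[1+ suc (n ℕ.+ m) ] (suc n) (cong ℤ.+_ cross) ⟩
  frac (suc (n ℕ.+ m)) n                          ∎
  where
  open Data.Nat.Solver.+-*-Solver
  cross : (1 ℕ.* suc n ℕ.+ suc m ℕ.* 1) ℕ.* suc n ≡ suc (suc (n ℕ.+ m)) ℕ.* (1 ℕ.* suc n)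
  cross = solve 2 (λ m n → (con 1 :* (con 1 :+ n) :+ (con 1 :+ m) :* con 1) :* (con 1 :+ n)
                         := (con 2 :+ n :+ m) :* (con 1 :* (con 1 :+ n))) refl m n

over1+-frac : ∀ m n p → over1+ (frac m n) p ≡ frac m (suc (m ℕ.+ n))
over1+-frac m n p = ÷-unique (frac m n) (onePlus (frac m n)) {{1+frac≢0}} (frac m (suc (m ℕ.+ n))) (begin
  frac m (suc (m ℕ.+ n)) * onePlus (frac m n)      ≡⟨ cong (frac m (suc (m ℕ.+ n)) *_) (onePlus-frac m n) ⟩
  frac m (suc (m ℕ.+ n)) * frac (suc (n ℕ.+ m)) n  ≡⟨ /-*-/ +[1+ m ] +[1+ suc (n ℕ.+ m) ] (suc (m ℕ.+ n)) n ⟩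
  (+[1+ m ] ℤ.* +[1+ suc (n ℕ.+ m) ]) / (suc (suc (m ℕ.+ n)) ℕ.* suc n)
    ≡⟨ /-cross (+[1+ m ] ℤ.* +[1+ suc (n ℕ.+ m) ]) (suc (suc (m ℕ.+ n)) ℕ.* suc n)
               +[1+ m ] (suc n) (cong ℤ.+_ cross) ⟩
  frac m n                                         ∎)
  where
  open Data.Nat.Solver.+-*-Solver
  1+frac≢0 : NonZero (onePlus (frac m n))
  1+frac≢0 = pos⇒nonZero (onePlus (frac m n)) {{pos+pos⇒pos 1ℚ {{_}} (frac m n) {{p}}}}
  cross : suc m ℕ.* suc (suc (n ℕ.+ m)) ℕ.* suc n ≡ suc m ℕ.* (suc (suc (m ℕ.+ n)) ℕ.* suc n)
  cross = solve 2 (λ m n → (con 1 :+ m) :* (con 2 :+ n :+ m) :* (con 1 :+ n)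
                         := (con 1 :+ m) :* ((con 2 :+ m :+ n) :* (con 1 :+ n))) refl m n

module _ (P : ℚ → Set) (P-1 : P 1ℚ)
         (P-onePlus : ∀ x px → P x → P (inv x px) → P (onePlus x))
         (P-over1+ : ∀ x px → P x → P (inv x px) → P (over1+ x px)) where

  private
    children : ∀ m n → P (frac m n) → P (frac n m) →
               P (frac (suc (n ℕ.+ m)) n) × P (frac n (suc (n ℕ.+ m)))
    children m n Pmn Pnm =
      subst P (onePlus-frac m n)
        (P-onePlus (frac m n) (frac-positive m n) Pmn (subst P (sym (inv-frac m n (frac-positive m n))) Pnm)) ,
      subst P (over1+-frac n m (frac-positive n m))
        (P-over1+ (frac n m) (frac-positive n m) Pnm (subst P (sym (inv-frac n m (frac-positive n m))) Pmn))

    -- Both orientations are carried along because each child needs P at x and at 1/x.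
    frac-pair : ∀ s m n → m ℕ.+ n ≡ s → P (frac m n) × P (frac n m)
    frac-pair = <-rec _ step
      where
      step : ∀ s → (∀ {r} → r ℕ.< s → ∀ m n → m ℕ.+ n ≡ r → P (frac m n) × P (frac n m)) →
             ∀ m n → m ℕ.+ n ≡ s → P (frac m n) × P (frac n m)
      step _ rec m n refl with ℕ.compare m n
      ... | ℕ.equal m     = subst P (sym (frac-diag m)) P-1 , subst P (sym (frac-diag m)) P-1
      ... | ℕ.greater n k = uncurry (children k n) (rec k+n<m+n k n refl)
        where
        k+n<m+n : k ℕ.+ n ℕ.< suc (n ℕ.+ k) ℕ.+ n
        k+n<m+n = ℕ.s≤s (subst (ℕ._≤ n ℕ.+ k ℕ.+ n) (ℕ.+-comm n k) (ℕ.m≤m+n (n ℕ.+ k) n))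
      ... | ℕ.less m k    = swap (uncurry (children k m) (rec k+m<m+n k m refl))
        where
        k+m<m+n : k ℕ.+ m ℕ.< m ℕ.+ suc (m ℕ.+ k)
        k+m<m+n = subst (ℕ._< m ℕ.+ suc (m ℕ.+ k)) (ℕ.+-comm m k) (ℕ.+-monoʳ-< m (ℕ.s≤s (ℕ.m≤n+m k m)))

  positive-induction : ∀ x → Positive x → P x
  positive-induction (mkℚ +[1+ m ] d _) _ = subst P (↥p/↧p≡p _) (proj₁ (frac-pair _ m d refl))
  positive-induction (mkℚ (ℤ.+ 0) _ _) px = ⊥-elim (ℤ.Positive.pos px)
  positive-induction (mkℚ ℤ.-[1+ _ ] _ _) px = ⊥-elim (ℤ.Positive.pos px)

pTimes-integer : ∀ {s} → IntegerSeries s → IntegerSeries (pTimes s)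
pTimes-integer sℤ zero    = isInteger-0
pTimes-integer sℤ (suc n) = sℤ n

oneS-integer : IntegerSeries oneS
oneS-integer zero    = isInteger-1
oneS-integer (suc n) = isInteger-0

fU-integer : ∀ {f} → IsFU f → ∀ x → Positive x → f x 0 ≡ 1ℚ × IntegerSeries (f x)
fU-integer {f} (f-onePlus , f-over1+ , f-one) = positive-induction P P-1 P-onePlus P-over1+
  where
  P : ℚ → Set
  P x = f x 0 ≡ 1ℚ × IntegerSeries (f x)

  P-1 : P 1ℚ
  P-1 = f-one 0 , λ n → subst IsInteger (sym (f-one n)) (oneS-integer n)

  P-onePlus : ∀ x px → P x → P (inv x px) → P (onePlus x)
  P-onePlus x px (_ , fxℤ) (f1/x0≡1 , f1/xℤ) =
    trans (f-onePlus x px 0) (trans (+-identityˡ _) f1/x0≡1) ,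
    λ n → subst IsInteger (sym (f-onePlus x px n)) (isInteger-+ (pTimes-integer fxℤ n) (f1/xℤ n))

  P-over1+ : ∀ x px → P x → P (inv x px) → P (over1+ x px)
  P-over1+ x px _ (f1/x0≡1 , f1/xℤ) =
    trans (f-over1+ x px 0) f1/x0≡1 , λ n → subst IsInteger (sym (f-over1+ x px n)) (f1/xℤ n)

theorem2 : (f : ℚ → Series) → IsFU f →
    (x : ℚ) (px : Positive x) →
      (f (inv x px) 0 ≢ 0ℚ) ×
      ∃ λ (a : ℕ → ℤ) → ∀ n → (f (inv x px) ·S fromℤS a) n ≡ f x n
theorem2 f isFU x px = t0≢0 , a , t·a≡fx
  where
  t : Series
  t = f (inv x px)

  t-integer : t 0 ≡ 1ℚ × IntegerSeries t
  t-integer = fU-integer isFU (inv x px) (1/pos⇒pos x {{px}})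

  t0≢0 : t 0 ≢ 0ℚ
  t0≢0 t0≡0 = 1≢0 (trans (sym (proj₁ t-integer)) t0≡0)

  quotient-integer : IntegerSeries (f x ÷S t)
  quotient-integer = ÷S-integer (proj₂ (fU-integer isFU x px)) (proj₂ t-integer)

  a : ℕ → ℤ
  a n = proj₁ (quotient-integer n)

  t·a≡fx : ∀ n → (t ·S fromℤS a) n ≡ f x n
  t·a≡fx n = begin
    (t ·S fromℤS a) n     ≡⟨ ·S-congʳ t (λ k → proj₂ (quotient-integer k)) n ⟨
    (t ·S (f x ÷S t)) n   ≡⟨ ·S-÷S t (proj₁ t-integer) (f x) n ⟩
    f x n                 ∎
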